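{- Let $k\ge2$, $n\ge1$, and let $f:\mathfrak T^n\to\mathbb R$ be $k$-submodular with $f(\mathbf 0)=0$. Then for every $K\in\mathfrak L^n$, $$B_K(f)\subseteq U(f)\subseteq U_K(f).$$
   Context: $\mathfrak T$ is a set consisting of a root $\mathbf o$ and a set $\mathfrak L$ of exactly $k$ leaves. Binary operations $\sqcap,\sqcup$ on $\mathfrak T$: $t\sqcap t=t\sqcup t=t$; for distinct leaves $a,b$: $a\sqcap b=a\sqcup b=\mathbf o$; for a leaf $a$: $a\sqcap\mathbf o=\mathbf o\sqcap a=\mathbf o$, $a\sqcup\mathbf o=\mathbf o\sqcup a=a$; they act componentwise on $\mathfrak T^n$; $\mathbf 0=(\mathbf o,\dots,\mathbf o)$. $f$ is $k$-submodular if $f(T\sqcap U)+f(T\sqcup U)\le f(T)+f(U)$ for all $T,U$. For $(x,L)\in\mathbb R_{\ge0}^n\times\mathfrak L^n$, $\overline{(x,L)}(T)=\sum_i\overline{(x,L)}_i(T_i)$ with $\overline{(x,L)}_i(\mathbf o)=0$, $\overline{(x,L)}_i(L_i)=x_i$, $\overline{(x,L)}_i(\ell)=-x_i$ for leaves $\ell\ne L_i$. $U(f)=\{(x,L)\in\mathbb R_{\ge0}^n\times\mathfrak L^n:\overline{(x,L)}(T)\le f(T)\ \forall T\in\mathfrak T^n\}$. Partial order $\le$ on $\mathfrak T$: $\mathbf o\le t$ for all $t$, leaves pairwise incomparable; on $\mathfrak T^n$ componentwise. For $K\in\mathfrak L^n$: $2^K=\{T\in\mathfrak T^n:T\le K\}$,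 $U_K(f)=\{(x,L)\in\mathbb R_{\ge0}^n\times\mathfrak L^n:\overline{(x,L)}(T)\le f(T)\ \forall T\in 2^K\}$, and $B_K(f)=\{(x,L)\in U_K(f):\overline{(x,L)}(K)=f(K)\}$. -}

module Defs where

open import Level using (Level) renaming (suc to lsuc; _⊔_ to _⊔ˡ_)
open import Data.Nat using (ℕ) renaming (zero to nzero; suc to nsuc)
open import Data.Fin using (Fin; zero; suc; _≟_)
open import Data.Product using (_×_)
open import Relation.Nullary using (yes; no)
open import Relation.Binary.PropositionalEquality using (_≡_)
open import Relation.Binary.Structures using (IsTotalOrder)
open import Algebra.Structures using (IsAbelianGroup)

-- Values: a totally ordered abelian group (ℝ is an instance; the
-- statement is quantified over all of them).

record OrderedAbelianGroup (c ℓ : Level) : Set (lsuc (c ⊔ˡ ℓ)) where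
  infixl 6 _+_
  infix 4 _≤_
  field
    Carrier        : Set c
    _+_            : Carrier → Carrier → Carrier
    0#             : Carrier
    -_             : Carrier → Carrier
    _≤_            : Carrier → Carrier → Set ℓ
    isAbelianGroup : IsAbelianGroup _≡_ _+_ 0# -_
    isTotalOrder   : IsTotalOrder _≡_ _≤_
    +-monoˡ-≤      : ∀ {a b} c → a ≤ b → a + c ≤ b + c

-- The star 𝔗 with root 𝐨 and leaves 𝔏 = Fin k

data Node (k : ℕ) : Set where
  𝐨    : Node k
  leaf : Fin k → Node k

_⊓ₜ_ : ∀ {k} → Node k → Node k → Node k
𝐨 ⊓ₜ t = 𝐨
leaf a ⊓ₜ 𝐨 = 𝐨
leaf a ⊓ₜ leaf b with a ≟ b
... | yes _ = leaf a
... | no  _ = 𝐨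

_⊔ₜ_ : ∀ {k} → Node k → Node k → Node k
𝐨 ⊔ₜ t = t
leaf a ⊔ₜ 𝐨 = leaf a
leaf a ⊔ₜ leaf b with a ≟ b
... | yes _ = leaf a
... | no  _ = 𝐨

data _≤ₜ_ {k : ℕ} : Node k → Node k → Set where
  𝐨≤    : ∀ {t} → 𝐨 ≤ₜ t
  refl≤ : ∀ {t} → t ≤ₜ t

Tn : ℕ → ℕ → Set
Tn k n = Fin n → Node k

Ln : ℕ → ℕ → Set
Ln k n = Fin n → Fin k

_⊓_ : ∀ {k n} → Tn k n → Tn k n → Tn k n
(T ⊓ U) i = T i ⊓ₜ U i

_⊔_ : ∀ {k n} → Tn k n → Tn k n → Tn k n
(T ⊔ U) i = T i ⊔ₜ U i

𝟎 : ∀ {k n} → Tn k n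
𝟎 i = 𝐨

-- T ≤ K (componentwise); T ∈ 2^K iff T ≤ leaves K
_≤ⁿ_ : ∀ {k n} → Tn k n → Tn k n → Set
T ≤ⁿ U = ∀ i → T i ≤ₜ U i

toTn : ∀ {k n} → Ln k n → Tn k n
toTn K i = leaf (K i)

module _ {c ℓ : Level} (G : OrderedAbelianGroup c ℓ) where
  open OrderedAbelianGroup G

  Σ : ∀ n → (Fin n → Carrier) → Carrier
  Σ nzero    g = 0#
  Σ (nsuc n) g = g zero + Σ n (λ i → g (suc i))

  KSubmodular : ∀ {k n} → (Tn k n → Carrier) → Set ℓ
  KSubmodular f = ∀ T U → f (T ⊓ U) + f (T ⊔ U) ≤ f T + f U

  -- pairs (x , L) ∈ ℝⁿ × 𝔏ⁿ (nonnegativity is part of membership below)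
  record Pair (k n : ℕ) : Set c where
    constructor _,_
    field
      x : Fin n → Carrier
      L : Ln k n

  Nonneg : ∀ {k n} → Pair k n → Set ℓ
  Nonneg p = ∀ i → 0# ≤ Pair.x p i

  barᵢ : ∀ {k} → Carrier → Fin k → Node k → Carrier
  barᵢ xi Li 𝐨 = 0#
  barᵢ xi Li (leaf l) with l ≟ Li
  ... | yes _ = xi
  ... | no  _ = - xi

  bar : ∀ {k n} → Pair k n → Tn k n → Carrier
  bar {n = n} p T = Σ n (λ i → barᵢ (Pair.x p i) (Pair.L p i) (T i))

  InU : ∀ {k n} → (Tn k n → Carrier) → Pair k n → Set ℓ
  InU f p = Nonneg p × (∀ T → bar p T ≤ f T)

  InUK : ∀ {k n} → (Tn k n → Carrier) → Ln k n → Pair k n → Set ℓ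
  InUK f K p = Nonneg p × (∀ T → T ≤ⁿ toTn K → bar p T ≤ f T)

  InBK : ∀ {k n} → (Tn k n → Carrier) → Ln k n → Pair k n → Set (c ⊔ˡ ℓ)
  InBK f K p = InUK f K p × (bar p (toTn K) ≡ f (toTn K))

module Submission where

-- Both inclusions are about the linear function  p̄ = \overline{(x,L)}.
-- U(f) ⊆ U_K(f) is immediate: U_K(f) only tests the inequality p̄ ≤ f on the
-- subfamily 2^K.  For B_K(f) ⊆ U(f) the key observation is that, for x ≥ 0,
-- p̄ is SUPERmodular:  p̄(T) + p̄(U) ≤ p̄(T ⊓ U) + p̄(T ⊔ U).  This is checked
-- coordinatewise on the star 𝔗 and summed.  Given p ∈ B_K(f) and any T, both
-- T ⊓ K and T ⊔ K lie in 2^K (a leaf tuple K is maximal), hence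
--   p̄(T) + f(K) = p̄(T) + p̄(K) ≤ p̄(T ⊓ K) + p̄(T ⊔ K)
--               ≤ f(T ⊓ K) + f(T ⊔ K) ≤ f(T) + f(K),
-- and cancelling f(K) gives p̄(T) ≤ f(T).

open import Defs
open import Level using (Level)
open import Data.Nat using (ℕ; _≤_) renaming (zero to nzero; suc to nsuc)
open import Data.Fin using (Fin; zero; suc; _≟_)
open import Data.Product using (_×_; _,_; proj₁)
open import Relation.Nullary using (yes; no)
open import Relation.Nullary.Negation using (contradiction)
open import Relation.Binary.PropositionalEquality using (_≡_; refl; sym; trans; cong)
open import Relation.Binary.Bundles using (Poset)
open import Relation.Binary.Structures using (IsTotalOrder)
open import Algebra.Bundles using (AbelianGroup)
open import Algebra.Structures using (IsAbelianGroup)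
import Algebra.Properties.Group as GroupProperties
import Algebra.Properties.CommutativeSemigroup as CommutativeSemigroupProperties
import Relation.Binary.Reasoning.PartialOrder as PosetReasoning

⊓ₜ-below : ∀ {k} (t u : Node k) → (t ⊓ₜ u) ≤ₜ u
⊓ₜ-below 𝐨        u        = 𝐨≤
⊓ₜ-below (leaf a) 𝐨        = 𝐨≤
⊓ₜ-below (leaf a) (leaf b) with a ≟ b
... | yes refl = refl≤
... | no  _    = 𝐨≤

-- A leaf is maximal, so the join of anything with a leaf stays below it.
⊔ₜ-below-leaf : ∀ {k} (t : Node k) (b : Fin k) → (t ⊔ₜ leaf b) ≤ₜ leaf b
⊔ₜ-below-leaf 𝐨        b = refl≤
⊔ₜ-below-leaf (leaf a) b with a ≟ b
... | yes refl = refl≤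
... | no  _    = 𝐨≤

⊓-in-2^K : ∀ {k n} (T : Tn k n) (K : Ln k n) → (T ⊓ toTn K) ≤ⁿ toTn K
⊓-in-2^K T K i = ⊓ₜ-below (T i) (leaf (K i))

⊔-in-2^K : ∀ {k n} (T : Tn k n) (K : Ln k n) → (T ⊔ toTn K) ≤ⁿ toTn K
⊔-in-2^K T K i = ⊔ₜ-below-leaf (T i) (K i)

module _ {c ℓ : Level} (G : OrderedAbelianGroup c ℓ) where
  open OrderedAbelianGroup G renaming (_≤_ to _≤G_)
  open IsAbelianGroup isAbelianGroup using (comm; identityˡ; inverseˡ; inverseʳ)
  open IsTotalOrder isTotalOrder using () renaming (refl to ≤G-refl; trans to ≤G-trans; reflexive to ≡⇒≤G)

  abelianGroup : AbelianGroup c c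
  abelianGroup = record { isAbelianGroup = isAbelianGroup }

  open GroupProperties (AbelianGroup.group abelianGroup) using (//-rightDividesʳ)
  open CommutativeSemigroupProperties (AbelianGroup.commutativeSemigroup abelianGroup) using (interchange)

  poset : Poset c c ℓ
  poset = record { isPartialOrder = IsTotalOrder.isPartialOrder isTotalOrder }

  open PosetReasoning poset

  +-monoʳ-≤ : ∀ {a b} d → a ≤G b → d + a ≤G d + b
  +-monoʳ-≤ {a} {b} d a≤b = begin
    d + a  ≡⟨ comm d a ⟩
    a + d  ≤⟨ +-monoˡ-≤ d a≤b ⟩
    b + d  ≡⟨ comm b d ⟩
    d + b  ∎

  +-mono-≤ : ∀ {a b d e} → a ≤G b → d ≤G e → a + d ≤G b + e
  +-mono-≤ {b = b} {d} a≤b d≤e = ≤G-trans (+-monoˡ-≤ d a≤b) (+-monoʳ-≤ b d≤e)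

  +-cancelʳ-≤ : ∀ {a b} d → a + d ≤G b + d → a ≤G b
  +-cancelʳ-≤ {a} {b} d a+d≤b+d = begin
    a              ≡⟨ sym (//-rightDividesʳ d a) ⟩
    (a + d) + - d  ≤⟨ +-monoˡ-≤ (- d) a+d≤b+d ⟩
    (b + d) + - d  ≡⟨ //-rightDividesʳ d b ⟩
    b              ∎

  neg-nonpos : ∀ {x} → 0# ≤G x → - x ≤G 0#
  neg-nonpos {x} 0≤x = begin
    - x        ≡⟨ sym (identityˡ (- x)) ⟩
    0# + - x   ≤⟨ +-monoˡ-≤ (- x) 0≤x ⟩
    x + - x    ≡⟨ inverseʳ x ⟩
    0#         ∎

  Σ-+ : ∀ n (g h : Fin n → Carrier) → Σ G n (λ i → g i + h i) ≡ Σ G n g + Σ G n h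
  Σ-+ nzero    g h = sym (identityˡ 0#)
  Σ-+ (nsuc n) g h = begin-equality
    (g zero + h zero) + Σ G n (λ i → g (suc i) + h (suc i))
      ≡⟨ cong ((g zero + h zero) +_) (Σ-+ n (λ i → g (suc i)) (λ i → h (suc i))) ⟩
    (g zero + h zero) + (Σ G n (λ i → g (suc i)) + Σ G n (λ i → h (suc i)))
      ≡⟨ interchange (g zero) (h zero) _ _ ⟩
    (g zero + Σ G n (λ i → g (suc i))) + (h zero + Σ G n (λ i → h (suc i)))  ∎

  Σ-mono : ∀ n (g h : Fin n → Carrier) → (∀ i → g i ≤G h i) → Σ G n g ≤G Σ G n h
  Σ-mono nzero    g h g≤h = ≤G-refl
  Σ-mono (nsuc n) g h g≤h = +-mono-≤ (g≤h zero) (Σ-mono n _ _ (λ i → g≤h (suc i)))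

  -- One coordinate of p̄ is supermodular on the star when its weight is ≥ 0:
  -- the only strict case is two distinct leaves, whose meet and join are 𝐨.
  barᵢ-supermodular : ∀ {k} {x : Carrier} (Lᵢ : Fin k) → 0# ≤G x → (t u : Node k) →
    barᵢ G x Lᵢ t + barᵢ G x Lᵢ u ≤G barᵢ G x Lᵢ (t ⊓ₜ u) + barᵢ G x Lᵢ (t ⊔ₜ u)
  barᵢ-supermodular Lᵢ 0≤x 𝐨        u        = ≤G-refl
  barᵢ-supermodular Lᵢ 0≤x (leaf a) 𝐨        = ≡⇒≤G (comm _ _)
  barᵢ-supermodular {x = x} Lᵢ 0≤x (leaf a) (leaf b) with a ≟ b
  ... | yes refl = ≤G-refl
  ... | no  a≢b with a ≟ Lᵢ | b ≟ Lᵢ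
  ...   | yes refl | yes refl = contradiction refl a≢b
  ...   | yes _    | no  _    = ≡⇒≤G (trans (inverseʳ x) (sym (identityˡ 0#)))
  ...   | no  _    | yes _    = ≡⇒≤G (trans (inverseˡ x) (sym (identityˡ 0#)))
  ...   | no  _    | no  _    = +-mono-≤ (neg-nonpos 0≤x) (neg-nonpos 0≤x)

  bar-supermodular : ∀ {k n} (p : Pair G k n) → Nonneg G p → (T U : Tn k n) →
    bar G p T + bar G p U ≤G bar G p (T ⊓ U) + bar G p (T ⊔ U)
  bar-supermodular {n = n} (x , L) 0≤x T U = begin
    bar G p T + bar G p U
      ≡⟨ sym (Σ-+ n _ _) ⟩
    Σ G n (λ i → barᵢ G (x i) (L i) (T i) + barᵢ G (x i) (L i) (U i))
      ≤⟨ Σ-mono n _ _ (λ i → barᵢ-supermodular (L i) (0≤x i) (T i) (U i)) ⟩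
    Σ G n (λ i → barᵢ G (x i) (L i) (T i ⊓ₜ U i) + barᵢ G (x i) (L i) (T i ⊔ₜ U i))
      ≡⟨ Σ-+ n _ _ ⟩
    bar G p (T ⊓ U) + bar G p (T ⊔ U)  ∎
    where p = x , L

  base-dominated : ∀ {k n} (f : Tn k n → Carrier) → KSubmodular G f → (K : Ln k n) →
    (p : Pair G k n) → InBK G f K p → ∀ T → bar G p T ≤G f T
  base-dominated f submod K p ((0≤x , p≤f) , tight) T = +-cancelʳ-≤ (f Kᵀ) (begin
    bar G p T + f Kᵀ                          ≡⟨ cong (bar G p T +_) (sym tight) ⟩
    bar G p T + bar G p Kᵀ                    ≤⟨ bar-supermodular p 0≤x T Kᵀ ⟩
    bar G p (T ⊓ Kᵀ) + bar G p (T ⊔ Kᵀ)       ≤⟨ +-mono-≤ (p≤f _ (⊓-in-2^K T K)) (p≤f _ (⊔-in-2^K T K)) ⟩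
    f (T ⊓ Kᵀ) + f (T ⊔ Kᵀ)                   ≤⟨ submod T Kᵀ ⟩
    f T + f Kᵀ                                ∎)
    where Kᵀ = toTn K

lemma1 : ∀ {c ℓ : Level} (G : OrderedAbelianGroup c ℓ) (k n : ℕ) → 2 ≤ k → 1 ≤ n →
           (f : Tn k n → OrderedAbelianGroup.Carrier G) →
           KSubmodular G f → f 𝟎 ≡ OrderedAbelianGroup.0# G →
           (K : Ln k n) →
           ((p : Pair G k n) → InBK G f K p → InU G f p) ×
           ((p : Pair G k n) → InU G f p → InUK G f K p)
lemma1 G k n _ _ f submod _ K = base⊆U , U⊆UK
  where
  base⊆U : (p : Pair G k n) → InBK G f K p → InU G f p
  base⊆U p inBK = proj₁ (proj₁ inBK) , base-dominated G f submod K p inBK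

  U⊆UK : (p : Pair G k n) → InU G f p → InUK G f K p
  U⊆UK p (0≤x , p≤f) = 0≤x , λ T _ → p≤f T
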